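{- Let $F$ be a field, $\Lambda=M_s(F)$, $A,B,C,D\in\Lambda$, and let $W=|w_{i,j}|$ ($i,j\ge1$) be the infinite matrix over $\Lambda$ with $w_{i+1,i}=A$, $w_{i,i+1}=C$, $w_{1,1}=D$, $w_{i,i}=B$ for $i>1$, and all other $w_{i,j}=0$. Fix $k\ge1$. Then the generating function $\sum_{n\ge0}b_nz^n\in\Lambda[[z]]$, where $b_n$ is the $(k,1)$ entry of $W^n$, viewed as an $s\times s$ matrix over $F[[z]]$, has all its matrix entries in $\mathcal{L}$.
   Context: A walk of length $l\ge0$ is an $(l+1)$-tuple $\alpha=(\alpha_0,\dots,\alpha_l)$ of integers with each $\alpha_i-\alpha_{i-1}\in\{ -1,0,1\}$; it is a walk from $\alpha_0$ to $\alpha_l$. Its weight is $w(\alpha)=1$ if $l=0$, else $w(\alpha)=U_1\cdots U_l$ with $U_i=A,B,C$ according as $\alpha_i-\alpha_{i-1}=-1,0,1$. $M_0=\sum w(\alpha)z^{l(\alpha)}$ over all walks from $0$ to $0$, $M_{ -1}$ the same sum over all walks from $-1$ to $0$, $M_1$ over all walks from $1$ to $0$; these are $s\times s$ matrices over $F[[z]]$. $\mathcal{L}$ is the subfield of the field of fractions of $F[[z]]$ generated over $F(z)$ by the matrix entries of $M_0,M_1,M_{ -1}$. -}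

module Defs where

open import Level using (Level; _⊔_) renaming (suc to lsuc)
open import Data.Nat using (ℕ; zero; suc; _∸_; _≟_)
open import Data.Fin using (Fin; toℕ) renaming (_≟_ to _≟ᶠ_)
open import Data.Integer using (ℤ; +_; -[1+_]; 0ℤ) renaming (_+_ to _+ℤ_; _≟_ to _≟ℤ_)
open import Data.List using (List; []; _∷_; map; filter; concatMap)
open import Data.Product using (Σ; ∃; _×_; _,_)
open import Relation.Nullary using (¬_; Dec; yes; no; does)
open import Relation.Binary.PropositionalEquality using (_≡_)
open import Algebra.Bundles using (CommutativeRing)

record Field (c ℓ : Level) : Set (lsuc (c ⊔ ℓ)) where
  field
    commutativeRing : CommutativeRing c ℓ
  open CommutativeRing commutativeRing public
  field
    0≉1     : ¬ (0# ≈ 1#)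
    inverse : ∀ x → ¬ (x ≈ 0#) → Σ Carrier (λ y → (x * y) ≈ 1#)

module FieldDefs {c ℓ} (F : Field c ℓ) where
  open Field F

  ΣF : (n : ℕ) → (Fin n → Carrier) → Carrier
  ΣF zero    f = 0#
  ΣF (suc n) f = f Fin.zero + ΣF n (λ i → f (Fin.suc i))
    where import Data.Fin as Fin

  Mat : ℕ → Set c
  Mat s = Fin s → Fin s → Carrier

  module _ {s : ℕ} where
    0M : Mat s
    0M i j = 0#

    1M : Mat s
    1M i j with i ≟ᶠ j
    ... | yes _ = 1#
    ... | no  _ = 0#

    _⊕_ : Mat s → Mat s → Mat s
    (X ⊕ Y) i j = X i j + Y i j

    _⊗_ : Mat s → Mat s → Mat s
    (X ⊗ Y) i j = ΣF s (λ m → X i m * Y m j)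

    sumM : List (Mat s) → Mat s
    sumM []       = 0M
    sumM (X ∷ Xs) = X ⊕ sumM Xs

  -- Walks.  A walk (α₀,…,α_l) is determined by its start α₀ and its
  -- list of steps α_i - α_{i-1} ∈ {-1,0,1}.
  data Step : Set where
    down stay up : Step

  diff : Step → ℤ
  diff down = -[1+ 0 ]
  diff stay = 0ℤ
  diff up   = + 1

  allSteps : ℕ → List (List Step)
  allSteps zero    = [] ∷ []
  allSteps (suc l) = concatMap (λ σ → (down ∷ σ) ∷ (stay ∷ σ) ∷ (up ∷ σ) ∷ []) (allSteps l)

  endpoint : ℤ → List Step → ℤ
  endpoint a []      = a
  endpoint a (u ∷ σ) = endpoint (a +ℤ diff u) σ

  module Walks {s : ℕ} (A B C : Mat s) where
    U : Step → Mat s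
    U down = A
    U stay = B
    U up   = C

    weight : List Step → Mat s
    weight []      = 1M
    weight (u ∷ σ) = U u ⊗ weight σ

    -- coefficient of z^l in M_a : sum of weights of walks of length l from a to 0
    Mcoef : ℤ → ℕ → Mat s
    Mcoef a l = sumM (map weight (filter (λ σ → endpoint a σ ≟ℤ 0ℤ) (allSteps l)))

  PS : Set c
  PS = ℕ → Carrier

  _≈ₚ_ : PS → PS → Set ℓ
  f ≈ₚ g = ∀ n → f n ≈ g n

  NonzeroP : PS → Set ℓ
  NonzeroP f = ¬ (∀ n → f n ≈ 0#)

  constP : Carrier → PS
  constP a zero    = a
  constP a (suc n) = 0#

  1ₚ : PS
  1ₚ = constP 1#

  zP : PS
  zP zero          = 0#
  zP (suc zero)    = 1#
  zP (suc (suc n)) = 0#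

  _+ₚ_ : PS → PS → PS
  (f +ₚ g) n = f n + g n

  -ₚ_ : PS → PS
  (-ₚ f) n = - f n

  _*ₚ_ : PS → PS → PS
  (f *ₚ g) n = ΣF (suc n) (λ i → f (toℕ i) * g (n ∸ toℕ i))

  -- The field 𝓛 ⊆ Frac(F[[z]]) generated over F(z) by the entries of
  -- M₀, M₁, M₋₁.  An element of Frac(F[[z]]) is represented by a pair
  -- (p , q) meaning p/q; InL p q says p/q ∈ 𝓛.
  module Generated {s : ℕ} (A B C : Mat s) where
    open Walks A B C

    entryP : ℤ → Fin s → Fin s → PS
    entryP a i j l = Mcoef a l i j

    data InL : PS → PS → Set (c ⊔ ℓ) where
      const  : ∀ a → InL (constP a) 1ₚ
      var    : InL zP 1ₚ
      gen₀   : ∀ i j → InL (entryP 0ℤ i j) 1ₚ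
      gen₁   : ∀ i j → InL (entryP (+ 1) i j) 1ₚ
      gen₋₁  : ∀ i j → InL (entryP -[1+ 0 ] i j) 1ₚ
      add    : ∀ {p q p′ q′} → InL p q → InL p′ q′ → InL ((p *ₚ q′) +ₚ (p′ *ₚ q)) (q *ₚ q′)
      neg    : ∀ {p q} → InL p q → InL (-ₚ p) q
      mul    : ∀ {p q p′ q′} → InL p q → InL p′ q′ → InL (p *ₚ p′) (q *ₚ q′)
      inv    : ∀ {p q} → InL p q → NonzeroP p → InL q p
      resp   : ∀ {p q p′ q′} → InL p q → (p *ₚ q′) ≈ₚ (p′ *ₚ q) → NonzeroP q′ → InL p′ q′

    _∈𝓛 : PS → Set (c ⊔ ℓ)
    f ∈𝓛 = InL f 1ₚ

  module Jacobi {s : ℕ} (A B C D : Mat s) where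
    w : ℕ → ℕ → Mat s
    w i j with i ≟ suc j | suc i ≟ j | i ≟ j | i ≟ 1
    ... | yes _ | _     | _     | _     = A
    ... | no _  | yes _ | _     | _     = C
    ... | no _  | no _  | yes _ | yes _ = D
    ... | no _  | no _  | yes _ | no _  = B
    ... | no _  | no _  | no _  | _     = 0M

    ΣM : ℕ → (ℕ → Mat s) → Mat s
    ΣM zero    f = 0M
    ΣM (suc N) f = ΣM N f ⊕ f (suc N)

    -- (W^n)_{i,j};  W^{n+1} = W · W^n, where (W·X)_{i,j} = Σ_m w_{i,m} X_{m,j}
    -- and w_{i,m} = 0 for m > i+1, so the sum is over m = 1 … i+1.
    Wpow : ℕ → ℕ → ℕ → Mat s
    Wpow zero i j with i ≟ j
    ... | yes _ = 1M
    ... | no  _ = 0M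
    Wpow (suc n) i j = ΣM (suc i) (λ m → w i m ⊗ Wpow n m j)

-- Let Fdown and Fup solve Fdown = zA + zB Fdown + zC Fdown² and Fup = zC + zB Fup + zA Fup²; they exist because
-- the right-hand sides are contractions for the z-adic metric. The walk generating functions M_a are the unique
-- solution of M_a = [a = 0] + zA M_{a-1} + zB M_a + zC M_{a+1}, and so is the family Fdown^a X (a ≥ 0),
-- Fup^(-a) X (a < 0) with X = (1 - zA Fup - zB - zC Fdown)⁻¹. Hence Fdown M₀ = M₁, i.e. Fdown = M₁ M₀⁻¹, and since
-- M₀ has constant term 1 its inverse is computed by Schur complements inside 𝓛; so Fdown has entries in 𝓛.
-- Likewise the generating functions G_j of the (j+1, 1) entries of Wⁿ are the unique solution of
-- G₀ = 1 + zD G₀ + zC G₁, G_{j+1} = zA G_j + zB G_{j+1} + zC G_{j+2}, which is solved by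
-- G_j = Fdown^j (1 - zD - zC Fdown)⁻¹, a matrix with entries in 𝓛.
module Submission where

open import Defs
open import Data.Nat using (ℕ; _≤_)
open import Data.Fin using (Fin)

open import Level using (_⊔_; 0ℓ)
open import Data.Nat using (zero; suc; _<_; _≤′_; ≤′-refl; ≤′-step; z≤n; s≤s) renaming (_≟_ to _≟ℕ_)
open import Data.Nat.Properties
  using (m<n⇒m<1+n; m≤n⇒m≤1+n; n≤1+n; ≤-refl; ≤-trans; ≤′⇒≤; ≤⇒≤′; <-irrefl)
open import Data.Nat.GeneralisedArithmetic using (fold)
open import Data.Fin using (zero; suc; _≟_)
open import Data.Integer as ℤ using (ℤ; +_; -[1+_]; 0ℤ) renaming (_+_ to _+ℤ_; _≟_ to _≟ℤ_)
import Data.Integer.Properties as ℤ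
open import Data.List using (List; []; _∷_; map; _++_; concatMap; filter)
open import Data.Product using (Σ; _,_; _×_; proj₁)
open import Data.Unit using (⊤; tt)
open import Data.Empty using (⊥-elim)
open import Relation.Nullary using (yes; no)
open import Relation.Binary.PropositionalEquality as ≡ using (_≡_)
open import Algebra.Bundles using (CommutativeRing; Ring)

module Matrices {c ℓ} (R : CommutativeRing c ℓ) where
  open CommutativeRing R hiding (zero)
  open import Algebra.Properties.Semiring.Sum semiring public
    using (sum; sum-cong-≋; ∑-distrib-+; ∑-comm; *-distribˡ-sum; *-distribʳ-sum; sum-replicate-zero)
  open import Algebra.Properties.Ring ring using (-‿distribʳ-*)
  open import Algebra.Properties.AbelianGroup +-abelianGroup using (⁻¹-∙-comm)
  open import Relation.Binary.Reasoning.Setoid setoid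

  Matrix : ℕ → Set c
  Matrix n = Fin n → Fin n → Carrier

  sum-zero : ∀ {n} {f : Fin n → Carrier} → (∀ i → f i ≈ 0#) → sum f ≈ 0#
  sum-zero {n} f≈0 = trans (sum-cong-≋ f≈0) (sum-replicate-zero n)

  -‿sum : ∀ {n} (f : Fin n → Carrier) → - sum f ≈ sum (λ i → - f i)
  -‿sum {zero}  f = trans (sym (+-identityˡ (- 0#))) (-‿inverseʳ 0#)
  -‿sum {suc n} f = trans (sym (⁻¹-∙-comm _ _)) (+-congˡ (-‿sum (λ i → f (suc i))))

  module _ {n : ℕ} where
    infix  4 _≈ᴹ_
    infixl 6 _+ᴹ_
    infixl 7 _*ᴹ_

    _≈ᴹ_ : Matrix n → Matrix n → Set ℓ
    X ≈ᴹ Y = ∀ i j → X i j ≈ Y i j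

    0ᴹ : Matrix n
    0ᴹ i j = 0#

    1ᴹ : Matrix n
    1ᴹ i j with i ≟ j
    ... | yes _ = 1#
    ... | no  _ = 0#

    _+ᴹ_ : Matrix n → Matrix n → Matrix n
    (X +ᴹ Y) i j = X i j + Y i j

    -ᴹ_ : Matrix n → Matrix n
    (-ᴹ X) i j = - X i j

    _*ᴹ_ : Matrix n → Matrix n → Matrix n
    (X *ᴹ Y) i j = sum (λ m → X i m * Y m j)

  1ᴹ-suc : ∀ {n} (i j : Fin n) → 1ᴹ (suc i) (suc j) ≈ 1ᴹ i j
  1ᴹ-suc i j with i ≟ j
  ... | yes _ = refl
  ... | no  _ = refl

  1ᴹ-sym : ∀ {n} (i j : Fin n) → 1ᴹ i j ≈ 1ᴹ j i
  1ᴹ-sym zero    zero    = refl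
  1ᴹ-sym zero    (suc j) = refl
  1ᴹ-sym (suc i) zero    = refl
  1ᴹ-sym (suc i) (suc j) = trans (1ᴹ-suc i j) (trans (1ᴹ-sym i j) (sym (1ᴹ-suc j i)))

  sum-1ᴹˡ : ∀ {n} (i : Fin n) (f : Fin n → Carrier) → sum (λ m → 1ᴹ i m * f m) ≈ f i
  sum-1ᴹˡ {suc n} zero f = begin
    1# * f zero + sum (λ m → 0# * f (suc m)) ≈⟨ +-cong (*-identityˡ _) (sum-zero {n} (λ m → zeroˡ _)) ⟩
    f zero + 0#                              ≈⟨ +-identityʳ _ ⟩
    f zero                                   ∎
  sum-1ᴹˡ {suc n} (suc i) f = begin
    0# * f zero + sum (λ m → 1ᴹ (suc i) (suc m) * f (suc m))
      ≈⟨ +-cong (zeroˡ _) (sum-cong-≋ {n} (λ m → *-congʳ (1ᴹ-suc i m))) ⟩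
    0# + sum (λ m → 1ᴹ i m * f (suc m))
      ≈⟨ +-identityˡ _ ⟩
    sum (λ m → 1ᴹ i m * f (suc m))
      ≈⟨ sum-1ᴹˡ i (λ m → f (suc m)) ⟩
    f (suc i) ∎

  sum-1ᴹʳ : ∀ {n} (j : Fin n) (f : Fin n → Carrier) → sum (λ m → f m * 1ᴹ m j) ≈ f j
  sum-1ᴹʳ {n} j f = trans (sum-cong-≋ {n} (λ m → trans (*-comm _ _) (*-congʳ (1ᴹ-sym m j)))) (sum-1ᴹˡ j f)

  module _ {n : ℕ} where
    *ᴹ-assoc : (X Y Z : Matrix n) → (X *ᴹ Y) *ᴹ Z ≈ᴹ X *ᴹ (Y *ᴹ Z)
    *ᴹ-assoc X Y Z i j = begin
      sum (λ m → sum (λ k → X i k * Y k m) * Z m j)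
        ≈⟨ sum-cong-≋ {n} (λ m → *-distribʳ-sum {n} _ _) ⟩
      sum (λ m → sum (λ k → X i k * Y k m * Z m j))
        ≈⟨ ∑-comm {n} {n} _ ⟩
      sum (λ k → sum (λ m → X i k * Y k m * Z m j))
        ≈⟨ sum-cong-≋ {n} (λ k → sum-cong-≋ {n} (λ m → *-assoc _ _ _)) ⟩
      sum (λ k → sum (λ m → X i k * (Y k m * Z m j)))
        ≈⟨ sum-cong-≋ {n} (λ k → sym (*-distribˡ-sum {n} _ _)) ⟩
      sum (λ k → X i k * sum (λ m → Y k m * Z m j)) ∎

    *ᴹ-distribˡ-+ᴹ : (X Y Z : Matrix n) → X *ᴹ (Y +ᴹ Z) ≈ᴹ X *ᴹ Y +ᴹ X *ᴹ Z
    *ᴹ-distribˡ-+ᴹ X Y Z i j =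
      trans (sum-cong-≋ {n} (λ m → distribˡ _ _ _)) (∑-distrib-+ (λ m → X i m * Y m j) (λ m → X i m * Z m j))

    *ᴹ-distribʳ-+ᴹ : (X Y Z : Matrix n) → (Y +ᴹ Z) *ᴹ X ≈ᴹ Y *ᴹ X +ᴹ Z *ᴹ X
    *ᴹ-distribʳ-+ᴹ X Y Z i j =
      trans (sum-cong-≋ {n} (λ m → distribʳ _ _ _)) (∑-distrib-+ (λ m → Y i m * X m j) (λ m → Z i m * X m j))

    matrixRing : Ring c ℓ
    matrixRing = record
      { Carrier = Matrix n ; _≈_ = _≈ᴹ_ ; _+_ = _+ᴹ_ ; _*_ = _*ᴹ_ ; -_ = -ᴹ_ ; 0# = 0ᴹ ; 1# = 1ᴹ
      ; isRing = record
        { +-isAbelianGroup = record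
          { isGroup = record
            { isMonoid = record
              { isSemigroup = record
                { isMagma = record
                  { isEquivalence = record
                    { refl = λ i j → refl ; sym = λ e i j → sym (e i j) ; trans = λ e f i j → trans (e i j) (f i j) }
                  ; ∙-cong = λ e f i j → +-cong (e i j) (f i j) }
                ; assoc = λ X Y Z i j → +-assoc _ _ _ }
              ; identity = (λ X i j → +-identityˡ _) , (λ X i j → +-identityʳ _) }
            ; inverse = (λ X i j → -‿inverseˡ _) , (λ X i j → -‿inverseʳ _)
            ; ⁻¹-cong = λ e i j → -‿cong (e i j) }
          ; comm = λ X Y i j → +-comm _ _ }
        ; *-cong = λ e f i j → sum-cong-≋ {n} (λ m → *-cong (e i m) (f m j))
        ; *-assoc = *ᴹ-assoc
        ; *-identity = (λ X i j → sum-1ᴹˡ i (λ m → X m j)) , (λ X i j → sum-1ᴹʳ j (λ m → X i m))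
        ; distrib = *ᴹ-distribˡ-+ᴹ , *ᴹ-distribʳ-+ᴹ } }

  module _ {k} (K : Carrier → Set k) where
    record IsInverseClosedSubring : Set (c ⊔ ℓ ⊔ k) where
      field
        ∈-resp : ∀ {x y} → x ≈ y → K x → K y
        0∈     : K 0#
        1∈     : K 1#
        +∈     : ∀ {x y} → K x → K y → K (x + y)
        -∈     : ∀ {x} → K x → K (- x)
        *∈     : ∀ {x y} → K x → K y → K (x * y)
        inverse∈ : ∀ {x y} → K x → x * y ≈ 1# → K y

      sum∈ : ∀ {n} {f : Fin n → Carrier} → (∀ i → K (f i)) → K (sum f)
      sum∈ {zero}  f∈ = 0∈
      sum∈ {suc n} f∈ = +∈ (f∈ zero) (sum∈ (λ i → f∈ (suc i)))

      1ᴹ∈ : ∀ {n} (i j : Fin n) → K (1ᴹ i j)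
      1ᴹ∈ i j with i ≟ j
      ... | yes _ = 1∈
      ... | no  _ = 0∈

  -- For X = (pivot, row; column, minor) and α a right inverse of the pivot, a right inverse T of the Schur
  -- complement minor - column α row gives the right inverse blockInverse T of X.
  module BlockInverse {n} (X : Matrix (suc n)) (α : Carrier) where
    open import Algebra.Solver.Ring.NaturalCoefficients.Default commutativeSemiring using (solve; _:=_; _:+_; _:*_)
    open import Algebra.Properties.Group +-group using (//-rightDividesˡ; //-rightDividesʳ; \\-leftDividesʳ)

    pivot : Carrier
    pivot = X zero zero

    row : Fin n → Carrier
    row j = X zero (suc j)

    column : Fin n → Carrier
    column i = X (suc i) zero

    minor : Matrix n
    minor i j = X (suc i) (suc j)

    schurComplement : Matrix n
    schurComplement i j = minor i j + - (column i * (α * row j))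

    schurComplement∈ : ∀ {k} {K : Carrier → Set k} → IsInverseClosedSubring K →
                       (∀ i j → K (X i j)) → K α → ∀ i j → K (schurComplement i j)
    schurComplement∈ K-subring X∈ α∈ i j = +∈ (X∈ _ _) (-∈ (*∈ (X∈ _ _) (*∈ α∈ (X∈ _ _))))
      where open IsInverseClosedSubring K-subring

    minor-sum : ∀ i (x : Fin n → Carrier) →
                sum (λ m → minor i m * x m) ≈
                sum (λ m → schurComplement i m * x m) + column i * α * sum (λ m → row m * x m)
    minor-sum i x = begin
      sum (λ m → minor i m * x m)
        ≈⟨ sum-cong-≋ {n} (λ m → *-congʳ (sym (//-rightDividesˡ _ (minor i m)))) ⟩
      sum (λ m → (schurComplement i m + column i * (α * row m)) * x m)
        ≈⟨ sum-cong-≋ {n} (λ m → distribʳ (x m) _ _) ⟩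
      sum (λ m → schurComplement i m * x m + column i * (α * row m) * x m)
        ≈⟨ ∑-distrib-+ {n} _ _ ⟩
      sum (λ m → schurComplement i m * x m) + sum (λ m → column i * (α * row m) * x m)
        ≈⟨ +-congˡ (sum-cong-≋ {n} (λ m →
             solve 4 (λ p q t y → p :* (q :* t) :* y := p :* q :* (t :* y)) refl _ _ _ _)) ⟩
      sum (λ m → schurComplement i m * x m) + sum (λ m → column i * α * (row m * x m))
        ≈⟨ +-congˡ (*-distribˡ-sum {n} _ _) ⟨
      sum (λ m → schurComplement i m * x m) + column i * α * sum (λ m → row m * x m) ∎

    module _ (T : Matrix n) where
      rowT : Fin n → Carrier
      rowT j = sum (λ m → row m * T m j)

      Tcolumn : Fin n → Carrier
      Tcolumn i = sum (λ m → T i m * column m)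

      rowTcolumn : Carrier
      rowTcolumn = sum (λ m → row m * Tcolumn m)

      blockInverse : Matrix (suc n)
      blockInverse zero    zero    = α + α * rowTcolumn * α
      blockInverse zero    (suc j) = - (α * rowT j)
      blockInverse (suc i) zero    = - (Tcolumn i * α)
      blockInverse (suc i) (suc j) = T i j

      blockInverse∈ : ∀ {k} {K : Carrier → Set k} → IsInverseClosedSubring K →
                      (∀ i j → K (X i j)) → K α → (∀ i j → K (T i j)) → ∀ i j → K (blockInverse i j)
      blockInverse∈ {K = K} K-subring X∈ α∈ T∈ = entry∈
        where
        open IsInverseClosedSubring K-subring
        Tcolumn∈ : ∀ i → K (Tcolumn i)
        Tcolumn∈ i = sum∈ (λ m → *∈ (T∈ i m) (X∈ (suc m) zero))
        entry∈ : ∀ i j → K (blockInverse i j)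
        entry∈ zero    zero    =
          +∈ α∈ (*∈ (*∈ α∈ (sum∈ (λ m → *∈ (X∈ zero (suc m)) (Tcolumn∈ m)))) α∈)
        entry∈ zero    (suc j) = -∈ (*∈ α∈ (sum∈ (λ m → *∈ (X∈ zero (suc m)) (T∈ m j))))
        entry∈ (suc i) zero    = -∈ (*∈ (Tcolumn∈ i) α∈)
        entry∈ (suc i) (suc j) = T∈ i j

      private
        sum-*-neg : ∀ (f g : Fin n → Carrier) y → sum (λ m → f m * - (g m * y)) ≈ - (sum (λ m → f m * g m) * y)
        sum-*-neg f g y = begin
          sum (λ m → f m * - (g m * y))
            ≈⟨ sum-cong-≋ {n} (λ m → trans (sym (-‿distribʳ-* _ _)) (-‿cong (sym (*-assoc _ _ _)))) ⟩
          sum (λ m → - (f m * g m * y))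
            ≈⟨ -‿sum {n} _ ⟨
          - sum (λ m → f m * g m * y)
            ≈⟨ -‿cong (*-distribʳ-sum {n} y _) ⟨
          - (sum (λ m → f m * g m) * y) ∎

        α-cancel : pivot * α ≈ 1# → ∀ x → pivot * (α * x) ≈ x
        α-cancel pα x = trans (sym (*-assoc _ _ _)) (trans (*-congʳ pα) (*-identityˡ x))

      module _ (pα : pivot * α ≈ 1#) (ST : schurComplement *ᴹ T ≈ᴹ 1ᴹ) where
        schurComplement-Tcolumn : ∀ i → sum (λ m → schurComplement i m * Tcolumn m) ≈ column i
        schurComplement-Tcolumn i = begin
          sum (λ m → schurComplement i m * sum (λ l → T m l * column l))
            ≈⟨ sum-cong-≋ {n} (λ m → *-distribˡ-sum {n} _ _) ⟩
          sum (λ m → sum (λ l → schurComplement i m * (T m l * column l)))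
            ≈⟨ ∑-comm {n} {n} _ ⟩
          sum (λ l → sum (λ m → schurComplement i m * (T m l * column l)))
            ≈⟨ sum-cong-≋ {n} (λ l → trans (sum-cong-≋ {n} (λ m → sym (*-assoc _ _ _)))
                                           (sym (*-distribʳ-sum {n} _ _))) ⟩
          sum (λ l → (schurComplement *ᴹ T) i l * column l)
            ≈⟨ sum-cong-≋ {n} (λ l → *-congʳ (ST i l)) ⟩
          sum (λ l → 1ᴹ i l * column l)
            ≈⟨ sum-1ᴹˡ i column ⟩
          column i ∎

        blockInverse-rightInverse : X *ᴹ blockInverse ≈ᴹ 1ᴹ
        blockInverse-rightInverse zero zero = begin
          pivot * (α + α * rowTcolumn * α) + sum (λ m → row m * - (Tcolumn m * α))
            ≈⟨ +-congˡ (sum-*-neg row Tcolumn α) ⟩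
          pivot * (α + α * rowTcolumn * α) + - (rowTcolumn * α)
            ≈⟨ +-congʳ (solve 3 (λ a b w → a :* (b :+ b :* w :* b) := a :* b :+ a :* b :* (w :* b))
                                refl pivot α rowTcolumn) ⟩
          pivot * α + pivot * α * (rowTcolumn * α) + - (rowTcolumn * α)
            ≈⟨ +-congʳ (+-cong pα (trans (*-congʳ pα) (*-identityˡ _))) ⟩
          1# + rowTcolumn * α + - (rowTcolumn * α)
            ≈⟨ //-rightDividesʳ _ 1# ⟩
          1# ∎
        blockInverse-rightInverse zero (suc j) = begin
          pivot * - (α * rowT j) + rowT j
            ≈⟨ +-congʳ (trans (sym (-‿distribʳ-* _ _)) (-‿cong (α-cancel pα (rowT j)))) ⟩
          - rowT j + rowT j
            ≈⟨ -‿inverseˡ (rowT j) ⟩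
          0# ∎
        blockInverse-rightInverse (suc i) zero = begin
          column i * (α + α * rowTcolumn * α) + sum (λ m → minor i m * - (Tcolumn m * α))
            ≈⟨ +-congˡ (sum-*-neg (minor i) Tcolumn α) ⟩
          column i * (α + α * rowTcolumn * α) + - (sum (λ m → minor i m * Tcolumn m) * α)
            ≈⟨ +-congˡ (-‿cong (*-congʳ (trans (minor-sum i Tcolumn) (+-congʳ (schurComplement-Tcolumn i))))) ⟩
          column i * (α + α * rowTcolumn * α) + - ((column i + column i * α * rowTcolumn) * α)
            ≈⟨ +-congʳ (solve 3 (λ c b w → c :* (b :+ b :* w :* b) := (c :+ c :* b :* w) :* b)
                                refl (column i) α rowTcolumn) ⟩
          (column i + column i * α * rowTcolumn) * α + - ((column i + column i * α * rowTcolumn) * α)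
            ≈⟨ -‿inverseʳ _ ⟩
          0# ∎
        blockInverse-rightInverse (suc i) (suc j) = begin
          column i * - (α * rowT j) + sum (λ m → minor i m * T m j)
            ≈⟨ +-cong (trans (sym (-‿distribʳ-* _ _)) (-‿cong (sym (*-assoc _ _ _))))
                      (minor-sum i (λ m → T m j)) ⟩
          - (column i * α * rowT j) + ((schurComplement *ᴹ T) i j + column i * α * rowT j)
            ≈⟨ +-congˡ (+-cong (ST i j) refl) ⟩
          - (column i * α * rowT j) + (1ᴹ i j + column i * α * rowT j)
            ≈⟨ trans (+-congˡ (+-comm _ _)) (\\-leftDividesʳ _ _) ⟩
          1ᴹ i j
            ≈⟨ 1ᴹ-suc i j ⟨
          1ᴹ (suc i) (suc j) ∎

module RingEquations {c ℓ} (R : Ring c ℓ) where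
  open Ring R
  open import Relation.Binary.Reasoning.Setoid setoid
  open import Algebra.Properties.Ring R using (-‿distribˡ-*)
  open import Algebra.Properties.Group +-group using (//-rightDividesˡ)

  quadratic-shift : ∀ P Q S X → P + Q * X + S * (X * X) ≈ X →
                    ∀ Y → X * Y ≈ P * Y + Q * (X * Y) + S * (X * (X * Y))
  quadratic-shift P Q S X X-eq Y = begin
    X * Y                                          ≈⟨ *-congʳ X-eq ⟨
    (P + Q * X + S * (X * X)) * Y                  ≈⟨ distribʳ Y _ _ ⟩
    (P + Q * X) * Y + S * (X * X) * Y              ≈⟨ +-cong (distribʳ Y _ _) (*-assoc _ _ _) ⟩
    P * Y + Q * X * Y + S * (X * X * Y)            ≈⟨ +-cong (+-congˡ (*-assoc _ _ _)) (*-congˡ (*-assoc _ _ _)) ⟩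
    P * Y + Q * (X * Y) + S * (X * (X * Y))        ∎

  rightInverse-expand : ∀ Q Y → (1# + - Q) * Y ≈ 1# → Y ≈ 1# + Q * Y
  rightInverse-expand Q Y inv = begin
    Y                              ≈⟨ //-rightDividesˡ (Q * Y) Y ⟨
    Y + - (Q * Y) + Q * Y          ≈⟨ +-congʳ (+-cong (*-identityˡ Y) (sym (-‿distribˡ-* Q Y))) ⟨
    1# * Y + - Q * Y + Q * Y       ≈⟨ +-congʳ (distribʳ Y 1# (- Q)) ⟨
    (1# + - Q) * Y + Q * Y         ≈⟨ +-congʳ inv ⟩
    1# + Q * Y                     ∎

  rightInverse-solve : ∀ X M N Y → X * M ≈ N → M * Y ≈ 1# → X ≈ N * Y
  rightInverse-solve X M N Y XM≈N MY≈1 = begin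
    X            ≈⟨ *-identityʳ X ⟨
    X * 1#       ≈⟨ *-congˡ MY≈1 ⟨
    X * (M * Y)  ≈⟨ *-assoc X M Y ⟨
    X * M * Y    ≈⟨ *-congʳ XM≈N ⟩
    N * Y        ∎

module PowerSeries {c ℓ} (F : Field c ℓ) where
  open Field F hiding (zero)
  open FieldDefs F
  open import Relation.Binary.Reasoning.Setoid setoid
  import Algebra.Solver.Ring.NaturalCoefficients.Default commutativeSemiring as Solver
  open Solver using (solve; _:=_; _:+_; _:*_; con)

  0ₚ : PS
  0ₚ _ = 0#

  shift : PS → PS
  shift f n = f (suc n)

  -- (f *ₚ g) (suc n) is definitionally f 0 * g (suc n) + (shift f *ₚ g) n;
  -- every property of *ₚ below is proved by induction along this unfolding.

  infix 4 _≈[<_]_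
  _≈[<_]_ : PS → ℕ → PS → Set ℓ
  f ≈[< n ] g = ∀ k → k < n → f k ≈ g k

  *ₚ-agree : ∀ {n f f′ g g′} → f ≈[< n ] f′ → g ≈[< n ] g′ → f *ₚ g ≈[< n ] f′ *ₚ g′
  *ₚ-agree f≈f′ g≈g′ zero    0<n       = +-congʳ (*-cong (f≈f′ 0 0<n) (g≈g′ 0 0<n))
  *ₚ-agree f≈f′ g≈g′ (suc k) (s≤s k<n) =
    +-cong (*-cong (f≈f′ 0 (s≤s z≤n)) (g≈g′ (suc k) (s≤s k<n)))
           (*ₚ-agree (λ i i<n → f≈f′ (suc i) (s≤s i<n)) (λ i i<n → g≈g′ i (m<n⇒m<1+n i<n)) k k<n)

  ≈0⇒*-absorbs : ∀ {a x y} → a ≈ 0# → a * x ≈ a * y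
  ≈0⇒*-absorbs a≈0 = trans (*-congʳ a≈0) (trans (zeroˡ _) (sym (trans (*-congʳ a≈0) (zeroˡ _))))

  *ₚ-contract : ∀ {n} u {f g} → u 0 ≈ 0# → f ≈[< n ] g → u *ₚ f ≈[< suc n ] u *ₚ g
  *ₚ-contract u u₀≈0 f≈g zero    _         = +-congʳ (≈0⇒*-absorbs u₀≈0)
  *ₚ-contract u u₀≈0 f≈g (suc k) (s≤s k<n) =
    +-cong (≈0⇒*-absorbs u₀≈0) (*ₚ-agree {f = shift u} (λ _ _ → refl) f≈g k k<n)

  *ₚ-cong : ∀ {f f′ g g′} → f ≈ₚ f′ → g ≈ₚ g′ → (f *ₚ g) ≈ₚ (f′ *ₚ g′)
  *ₚ-cong f≈f′ g≈g′ n = *ₚ-agree (λ k _ → f≈f′ k) (λ k _ → g≈g′ k) n ≤-refl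

  constantTerm-*ₚ : ∀ f g → (f *ₚ g) 0 ≈ f 0 * g 0
  constantTerm-*ₚ f g = +-identityʳ _

  0ₚ-*ₚ : ∀ g → (0ₚ *ₚ g) ≈ₚ 0ₚ
  0ₚ-*ₚ g zero    = trans (+-identityʳ _) (zeroˡ _)
  0ₚ-*ₚ g (suc n) = trans (+-cong (zeroˡ _) (0ₚ-*ₚ g n)) (+-identityʳ 0#)

  constP-*ₚ : ∀ a g → (constP a *ₚ g) ≈ₚ (λ n → a * g n)
  constP-*ₚ a g zero    = +-identityʳ _
  constP-*ₚ a g (suc n) = trans (+-congˡ (0ₚ-*ₚ g n)) (+-identityʳ _)

  scale-*ₚ : ∀ a f g → ((λ n → a * f n) *ₚ g) ≈ₚ (λ n → a * (f *ₚ g) n)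
  scale-*ₚ a f g zero    = solve 3 (λ a x y → a :* x :* y :+ con 0 := a :* (x :* y :+ con 0)) refl a (f 0) (g 0)
  scale-*ₚ a f g (suc n) = trans (+-cong (*-assoc _ _ _) (scale-*ₚ a (shift f) g n)) (sym (distribˡ a _ _))

  *ₚ-distribʳ : ∀ h f g → ((f +ₚ g) *ₚ h) ≈ₚ ((f *ₚ h) +ₚ (g *ₚ h))
  *ₚ-distribʳ h f g zero    = solve 3 (λ x y z → (x :+ y) :* z :+ con 0 := (x :* z :+ con 0) :+ (y :* z :+ con 0))
                                refl (f 0) (g 0) (h 0)
  *ₚ-distribʳ h f g (suc n) = trans (+-cong (distribʳ _ _ _) (*ₚ-distribʳ h (shift f) (shift g) n))
                                    (solve 4 (λ a b c d → (a :+ b) :+ (c :+ d) := (a :+ c) :+ (b :+ d)) refl _ _ _ _)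

  *ₚ-comm : ∀ f g → (f *ₚ g) ≈ₚ (g *ₚ f)
  *ₚ-comm f g zero             = +-congʳ (*-comm _ _)
  *ₚ-comm f g (suc zero)       = solve 4 (λ a b c d → a :* b :+ (c :* d :+ con 0) := d :* c :+ (b :* a :+ con 0))
                                   refl (f 0) (g 1) (f 1) (g 0)
  *ₚ-comm f g (suc (suc n)) = begin
    f 0 * g (suc (suc n)) + (shift f *ₚ g) (suc n)
      ≈⟨ +-congˡ (*ₚ-comm (shift f) g (suc n)) ⟩
    f 0 * g (suc (suc n)) + (g 0 * f (suc (suc n)) + (shift g *ₚ shift f) n)
      ≈⟨ +-congˡ (+-congˡ (*ₚ-comm (shift g) (shift f) n)) ⟩
    f 0 * g (suc (suc n)) + (g 0 * f (suc (suc n)) + (shift f *ₚ shift g) n)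
      ≈⟨ solve 3 (λ a b c → a :+ (b :+ c) := b :+ (a :+ c)) refl _ _ _ ⟩
    g 0 * f (suc (suc n)) + (f 0 * g (suc (suc n)) + (shift f *ₚ shift g) n)
      ≈⟨ +-congˡ (*ₚ-comm (shift g) f (suc n)) ⟨
    g 0 * f (suc (suc n)) + (shift g *ₚ f) (suc n) ∎

  *ₚ-assoc : ∀ f g h → ((f *ₚ g) *ₚ h) ≈ₚ (f *ₚ (g *ₚ h))
  *ₚ-assoc f g h zero    = solve 3 (λ x y z → (x :* y :+ con 0) :* z :+ con 0 := x :* (y :* z :+ con 0) :+ con 0)
                             refl (f 0) (g 0) (h 0)
  *ₚ-assoc f g h (suc n) = begin
    (f *ₚ g) 0 * h (suc n) + (shift (f *ₚ g) *ₚ h) n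
      ≈⟨ +-congˡ (*ₚ-distribʳ h (λ i → f 0 * shift g i) (shift f *ₚ g) n) ⟩
    (f *ₚ g) 0 * h (suc n) + (((λ i → f 0 * shift g i) *ₚ h) n + ((shift f *ₚ g) *ₚ h) n)
      ≈⟨ +-cong (*-congʳ (constantTerm-*ₚ f g))
                (+-cong (scale-*ₚ (f 0) (shift g) h n) (*ₚ-assoc (shift f) g h n)) ⟩
    f 0 * g 0 * h (suc n) + (f 0 * (shift g *ₚ h) n + (shift f *ₚ (g *ₚ h)) n)
      ≈⟨ solve 5 (λ a b c d e → a :* b :* c :+ (a :* d :+ e) := a :* (b :* c :+ d) :+ e) refl _ _ _ _ _ ⟩
    f 0 * (g *ₚ h) (suc n) + (shift f *ₚ (g *ₚ h)) n ∎

  psRing : CommutativeRing c ℓ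
  psRing = record
    { Carrier = PS ; _≈_ = _≈ₚ_ ; _+_ = _+ₚ_ ; _*_ = _*ₚ_ ; -_ = -ₚ_ ; 0# = 0ₚ ; 1# = 1ₚ
    ; isCommutativeRing = record
      { isRing = record
        { +-isAbelianGroup = record
          { isGroup = record
            { isMonoid = record
              { isSemigroup = record
                { isMagma = record
                  { isEquivalence = record
                    { refl = λ n → refl ; sym = λ e n → sym (e n) ; trans = λ e e′ n → trans (e n) (e′ n) }
                  ; ∙-cong = λ e e′ n → +-cong (e n) (e′ n) }
                ; assoc = λ f g h n → +-assoc _ _ _ }
              ; identity = (λ f n → +-identityˡ _) , (λ f n → +-identityʳ _) }
            ; inverse = (λ f n → -‿inverseˡ _) , (λ f n → -‿inverseʳ _)
            ; ⁻¹-cong = λ e n → -‿cong (e n) }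
          ; comm = λ f g n → +-comm _ _ }
        ; *-cong = *ₚ-cong
        ; *-assoc = *ₚ-assoc
        ; *-identity = 1ₚ-*ₚ , (λ f n → trans (*ₚ-comm f 1ₚ n) (1ₚ-*ₚ f n))
        ; distrib = (λ h f g n → trans (*ₚ-comm h (f +ₚ g) n) (trans (*ₚ-distribʳ h f g n)
                                   (+-cong (*ₚ-comm f h n) (*ₚ-comm g h n))))
                  , *ₚ-distribʳ }
      ; *-comm = *ₚ-comm } }
    where
    1ₚ-*ₚ : ∀ f → (1ₚ *ₚ f) ≈ₚ f
    1ₚ-*ₚ f n = trans (constP-*ₚ 1# f n) (*-identityˡ _)

  module P = CommutativeRing psRing

module Contraction {c ℓ} (F : Field c ℓ) where
  open Field F hiding (zero)
  open FieldDefs F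
  open PowerSeries F

  module _ {I : Set} (Φ : (I → PS) → (I → PS))
           (contractive : ∀ {n x y} → (∀ i → x i ≈[< n ] y i) → ∀ i → Φ x i ≈[< suc n ] Φ y i) where
    private
      approx : ℕ → I → PS
      approx zero    _ = 0ₚ
      approx (suc n)   = Φ (approx n)

      approx-step : ∀ n i → approx n i ≈[< n ] approx (suc n) i
      approx-step zero    i k ()
      approx-step (suc n)   = contractive (approx-step n)

      approx-stable : ∀ {m n} → m ≤′ n → ∀ i → approx m i ≈[< m ] approx n i
      approx-stable ≤′-refl          i k k<m = refl
      approx-stable (≤′-step m≤′n) i k k<m =
        trans (approx-stable m≤′n i k k<m) (approx-step _ i k (≤-trans k<m (≤′⇒≤ m≤′n)))

    -- approx (suc k) is already stable up to degree k
    fixpoint : I → PS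
    fixpoint i k = approx (suc k) i k

    fixpoint-approx : ∀ n i → fixpoint i ≈[< n ] approx n i
    fixpoint-approx n i k k<n = approx-stable (≤⇒≤′ k<n) i k ≤-refl

    fixpoint-eq : ∀ i → Φ fixpoint i ≈ₚ fixpoint i
    fixpoint-eq i k = contractive (fixpoint-approx k) i k ≤-refl

module SeriesMatrices {c ℓ} (F : Field c ℓ) where
  open Field F hiding (zero)
  open FieldDefs F using (PS; _≈ₚ_; _*ₚ_; constP; zP; 1ₚ)
  open PowerSeries F
  open Contraction F
  open Matrices psRing public
  module Fᴹ = Matrices commutativeRing
  open import Relation.Binary.Reasoning.Setoid setoid

  infix 4 _≈ᴹ[<_]_
  _≈ᴹ[<_]_ : ∀ {s} → Matrix s → ℕ → Matrix s → Set ℓ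
  X ≈ᴹ[< n ] Y = ∀ i j → X i j ≈[< n ] Y i j

  sum-agree : ∀ {m n} {f g : Fin m → PS} → (∀ i → f i ≈[< n ] g i) → sum f ≈[< n ] sum g
  sum-agree {zero}  f≈g k _   = refl
  sum-agree {suc m} f≈g k k<n = +-cong (f≈g zero k k<n) (sum-agree {m} (λ i → f≈g (suc i)) k k<n)

  +ᴹ-agree : ∀ {s n} {X X′ Y Y′ : Matrix s} →
             X ≈ᴹ[< n ] X′ → Y ≈ᴹ[< n ] Y′ → X +ᴹ Y ≈ᴹ[< n ] X′ +ᴹ Y′
  +ᴹ-agree X≈X′ Y≈Y′ i j k k<n = +-cong (X≈X′ i j k k<n) (Y≈Y′ i j k k<n)

  *ᴹ-agree : ∀ {s n} {X X′ Y Y′ : Matrix s} →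
             X ≈ᴹ[< n ] X′ → Y ≈ᴹ[< n ] Y′ → X *ᴹ Y ≈ᴹ[< n ] X′ *ᴹ Y′
  *ᴹ-agree {s} X≈X′ Y≈Y′ i j = sum-agree {s} (λ m → *ₚ-agree (X≈X′ i m) (Y≈Y′ m j))

  zᴹ : ∀ {s} → Fᴹ.Matrix s → Matrix s
  zᴹ U i j = zP *ₚ constP (U i j)

  zᴹ-constantTerm : ∀ {s} (U : Fᴹ.Matrix s) i j → zᴹ U i j 0 ≈ 0#
  zᴹ-constantTerm U i j = trans (constantTerm-*ₚ zP (constP (U i j))) (zeroˡ _)

  zᴹ-contract : ∀ {s n} (U : Fᴹ.Matrix s) {X Y : Matrix s} →
                X ≈ᴹ[< n ] Y → zᴹ U *ᴹ X ≈ᴹ[< suc n ] zᴹ U *ᴹ Y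
  zᴹ-contract {s} U X≈Y i j = sum-agree {s} (λ m → *ₚ-contract (zᴹ U i m) (zᴹ-constantTerm U i m) (X≈Y m j))

  module _ {s} (Φ : Matrix s → Matrix s)
           (contractive : ∀ {n X Y} → X ≈ᴹ[< n ] Y → Φ X ≈ᴹ[< suc n ] Φ Y) where
    private
      Φ′ : (Fin s × Fin s → PS) → (Fin s × Fin s → PS)
      Φ′ x (i , j) = Φ (λ i j → x (i , j)) i j

      contractive′ : ∀ {n x y} → (∀ p → x p ≈[< n ] y p) → ∀ p → Φ′ x p ≈[< suc n ] Φ′ y p
      contractive′ x≈y (i , j) = contractive (λ i j → x≈y (i , j)) i j

    fixpointᴹ : Matrix s
    fixpointᴹ i j = fixpoint Φ′ contractive′ (i , j)

    fixpointᴹ-eq : Φ fixpointᴹ ≈ᴹ fixpointᴹ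
    fixpointᴹ-eq i j = fixpoint-eq Φ′ contractive′ (i , j)

  coefficient : ∀ {s} → Matrix s → ℕ → Fᴹ.Matrix s
  coefficient X n i j = X i j n

  constᴹ : ∀ {s} → Fᴹ.Matrix s → Matrix s
  constᴹ E i j = constP (E i j)

  constP-0# : constP 0# ≈ₚ 0ₚ
  constP-0# zero    = refl
  constP-0# (suc n) = refl

  constᴹ-0ᴹ : ∀ {s} → constᴹ {s} Fᴹ.0ᴹ ≈ᴹ 0ᴹ
  constᴹ-0ᴹ i j = constP-0#

  constᴹ-1ᴹ : ∀ {s} → constᴹ {s} Fᴹ.1ᴹ ≈ᴹ 1ᴹ
  constᴹ-1ᴹ i j with i ≟ j
  ... | yes _ = λ n → refl
  ... | no  _ = constP-0#

  sum-coefficient : ∀ {m} (f : Fin m → PS) k → sum f k ≈ Fᴹ.sum (λ i → f i k)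
  sum-coefficient {zero}  f k = refl
  sum-coefficient {suc m} f k = +-congˡ (sum-coefficient (λ i → f (suc i)) k)

  zP-*ₚ-suc : ∀ g n → (zP *ₚ g) (suc n) ≈ g n
  zP-*ₚ-suc g n = begin
    0# * g (suc n) + (shift zP *ₚ g) n ≈⟨ +-cong (zeroˡ _) (*ₚ-cong {g = g} shift-zP (λ _ → refl) n) ⟩
    0# + (1ₚ *ₚ g) n                    ≈⟨ +-identityˡ _ ⟩
    (1ₚ *ₚ g) n                         ≈⟨ P.*-identityˡ g n ⟩
    g n                                 ∎
    where
    shift-zP : shift zP ≈ₚ 1ₚ
    shift-zP zero    = refl
    shift-zP (suc n) = refl

  zᴹ-*ᴹ-constantTerm : ∀ {s} (U : Fᴹ.Matrix s) (Y : Matrix s) → coefficient (zᴹ U *ᴹ Y) 0 Fᴹ.≈ᴹ Fᴹ.0ᴹ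
  zᴹ-*ᴹ-constantTerm {s} U Y i j = trans (sum-coefficient {s} _ 0)
    (Fᴹ.sum-zero {s} (λ m → trans (constantTerm-*ₚ (zᴹ U i m) (Y m j))
                                  (trans (*-congʳ (zᴹ-constantTerm U i m)) (zeroˡ _))))

  zᴹ-*ᴹ-coefficient : ∀ {s} (U : Fᴹ.Matrix s) (Y : Matrix s) n →
                      coefficient (zᴹ U *ᴹ Y) (suc n) Fᴹ.≈ᴹ U Fᴹ.*ᴹ coefficient Y n
  zᴹ-*ᴹ-coefficient {s} U Y n i j = trans (sum-coefficient {s} _ (suc n)) (Fᴹ.sum-cong-≋ {s} entry)
    where
    entry : ∀ m → (zᴹ U i m *ₚ Y m j) (suc n) ≈ U i m * Y m j n
    entry m = begin
      ((zP *ₚ constP (U i m)) *ₚ Y m j) (suc n) ≈⟨ P.*-assoc zP (constP (U i m)) (Y m j) (suc n) ⟩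
      (zP *ₚ (constP (U i m) *ₚ Y m j)) (suc n) ≈⟨ zP-*ₚ-suc (constP (U i m) *ₚ Y m j) n ⟩
      (constP (U i m) *ₚ Y m j) n               ≈⟨ constP-*ₚ (U i m) (Y m j) n ⟩
      U i m * Y m j n                           ∎

module SeriesInverse {c ℓ} (F : Field c ℓ) where
  open Field F hiding (zero; inverse)
  open FieldDefs F using (PS; _≈ₚ_; _+ₚ_; -ₚ_; _*ₚ_; 1ₚ)
  open PowerSeries F
  open Contraction F
  open SeriesMatrices F
  open import Algebra.Properties.Group P.+-group using (//-rightDividesˡ)
  open import Algebra.Properties.Group +-group using (ε⁻¹≈ε)
  open import Relation.Binary.Reasoning.Setoid P.setoid

  -- the inverse is the fixed point of b ↦ 1 - (a - 1) b, a contraction since a - 1 has no constant term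
  inverseₚ : ∀ a → a 0 ≈ 1# → Σ PS (λ b → (a *ₚ b) ≈ₚ 1ₚ)
  inverseₚ a a₀≈1 = b , a*b≈1
    where
    u : PS
    u = a +ₚ (-ₚ 1ₚ)

    Φ : (⊤ → PS) → (⊤ → PS)
    Φ x _ = 1ₚ +ₚ (-ₚ (u *ₚ x tt))

    contractive : ∀ {n x y} → (∀ i → x i ≈[< n ] y i) → ∀ i → Φ x i ≈[< suc n ] Φ y i
    contractive x≈y _ k k<n =
      +-congˡ (-‿cong (*ₚ-contract u (trans (+-congʳ a₀≈1) (-‿inverseʳ 1#)) (x≈y tt) k k<n))

    b : PS
    b = fixpoint Φ contractive tt

    a*b≈1 : (a *ₚ b) ≈ₚ 1ₚ
    a*b≈1 = begin
      a *ₚ b                              ≈⟨ P.*-congʳ (P.sym (//-rightDividesˡ 1ₚ a)) ⟩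
      (u +ₚ 1ₚ) *ₚ b                      ≈⟨ P.distribʳ b u 1ₚ ⟩
      (u *ₚ b) +ₚ (1ₚ *ₚ b)               ≈⟨ P.+-cong P.refl (P.*-identityˡ b) ⟩
      (u *ₚ b) +ₚ b                       ≈⟨ P.+-congˡ (P.sym (fixpoint-eq Φ contractive tt)) ⟩
      (u *ₚ b) +ₚ (1ₚ +ₚ (-ₚ (u *ₚ b)))   ≈⟨ P.+-comm _ _ ⟩
      (1ₚ +ₚ (-ₚ (u *ₚ b))) +ₚ (u *ₚ b)   ≈⟨ //-rightDividesˡ (u *ₚ b) 1ₚ ⟩
      1ₚ                                  ∎

  HasConstantTermOne : ∀ {n} → Matrix n → Set ℓ
  HasConstantTermOne X = coefficient X 0 Fᴹ.≈ᴹ Fᴹ.1ᴹ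

  open BlockInverse using (schurComplement; column; row; schurComplement∈; blockInverse; blockInverse∈;
                           blockInverse-rightInverse)

  -- the column below the pivot vanishes at z = 0, so the correction term does too
  schurComplement-constantTerm : ∀ {n} (X : Matrix (suc n)) α → HasConstantTermOne X →
                                 HasConstantTermOne (schurComplement X α)
  schurComplement-constantTerm X α X₀≈1 i j = trans
    (+-cong (trans (X₀≈1 (suc i) (suc j)) (Fᴹ.1ᴹ-suc i j))
            (-‿cong (trans (constantTerm-*ₚ (column X α i) (α *ₚ row X α j))
                           (trans (*-congʳ (X₀≈1 (suc i) zero)) (zeroˡ _)))))
    (trans (+-congˡ ε⁻¹≈ε) (+-identityʳ _))

  record RightInverse {k} (K : PS → Set k) {n} (X : Matrix n) : Set (c ⊔ ℓ ⊔ k) where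
    field
      inverse        : Matrix n
      isRightInverse : X *ᴹ inverse ≈ᴹ 1ᴹ
      entries∈       : ∀ i j → K (inverse i j)

  module _ {k} {K : PS → Set k} (K-subring : IsInverseClosedSubring K) where
    open IsInverseClosedSubring K-subring

    rightInverse : ∀ {n} (X : Matrix n) → HasConstantTermOne X → (∀ i j → K (X i j)) → RightInverse K X
    rightInverse {zero}  X _ _ = record { inverse = λ () ; isRightInverse = λ () ; entries∈ = λ () }
    rightInverse {suc n} X X₀≈1 X∈ with inverseₚ (X zero zero) (X₀≈1 zero zero)
    ... | α , pα = record
      { inverse        = blockInverse X α S⁻¹.inverse
      ; isRightInverse = blockInverse-rightInverse X α S⁻¹.inverse pα S⁻¹.isRightInverse
      ; entries∈       = blockInverse∈ X α S⁻¹.inverse K-subring X∈ α∈ S⁻¹.entries∈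
      }
      where
      α∈ : K α
      α∈ = inverse∈ (X∈ zero zero) pα
      module S⁻¹ = RightInverse (rightInverse (schurComplement X α) (schurComplement-constantTerm X α X₀≈1)
                                              (schurComplement∈ X α K-subring X∈ α∈))

-- The system  X i = source i + z · Σ { U · X j ∣ (U , j) ∈ terms i },  over F[[z]] or coefficientwise.
module LinearSystem {c ℓ} (F : Field c ℓ) {s : ℕ} {I : Set}
                    (source : I → FieldDefs.Mat F s) (terms : I → List (FieldDefs.Mat F s × I)) where
  open Field F hiding (zero)
  open SeriesMatrices F
  module FR = Ring (Fᴹ.matrixRing {s})

  combine : List (Fᴹ.Matrix s × I) → (I → Fᴹ.Matrix s) → Fᴹ.Matrix s
  combine []             x = Fᴹ.0ᴹ
  combine ((U , j) ∷ ts) x = U Fᴹ.*ᴹ x j Fᴹ.+ᴹ combine ts x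

  combineₚ : List (Fᴹ.Matrix s × I) → (I → Matrix s) → Matrix s
  combineₚ []             X = 0ᴹ
  combineₚ ((U , j) ∷ ts) X = zᴹ U *ᴹ X j +ᴹ combineₚ ts X

  IsCoefficientSolution : (I → ℕ → Fᴹ.Matrix s) → Set ℓ
  IsCoefficientSolution b =
    (∀ i → b i 0 Fᴹ.≈ᴹ source i) × (∀ i n → b i (suc n) Fᴹ.≈ᴹ combine (terms i) (λ j → b j n))

  IsSeriesSolution : (I → Matrix s) → Set ℓ
  IsSeriesSolution X = ∀ i → X i ≈ᴹ constᴹ (source i) +ᴹ combineₚ (terms i) X

  combine-cong : ∀ ts {x y : I → Fᴹ.Matrix s} → (∀ j → x j Fᴹ.≈ᴹ y j) → combine ts x Fᴹ.≈ᴹ combine ts y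
  combine-cong []             x≈y = FR.refl
  combine-cong ((U , j) ∷ ts) x≈y = FR.+-cong (FR.*-congˡ (x≈y j)) (combine-cong ts x≈y)

  combine-0ᴹ : ∀ ts → combine ts (λ _ → Fᴹ.0ᴹ) Fᴹ.≈ᴹ Fᴹ.0ᴹ
  combine-0ᴹ []             = FR.refl
  combine-0ᴹ ((U , j) ∷ ts) = FR.trans (FR.+-cong (FR.zeroʳ U) (combine-0ᴹ ts)) (FR.+-identityˡ _)

  combine-+ᴹ : ∀ ts (x y : I → Fᴹ.Matrix s) →
               combine ts x Fᴹ.+ᴹ combine ts y Fᴹ.≈ᴹ combine ts (λ j → x j Fᴹ.+ᴹ y j)
  combine-+ᴹ []             x y = FR.+-identityˡ _
  combine-+ᴹ ((U , j) ∷ ts) x y =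
    FR.trans (interchange _ _ _ _) (FR.+-cong (FR.sym (FR.distribˡ U (x j) (y j))) (combine-+ᴹ ts x y))
    where open import Algebra.Properties.CommutativeSemigroup FR.+-commutativeSemigroup using (interchange)

  combineₚ-constantTerm : ∀ ts X → coefficient (combineₚ ts X) 0 Fᴹ.≈ᴹ Fᴹ.0ᴹ
  combineₚ-constantTerm []             X = FR.refl
  combineₚ-constantTerm ((U , j) ∷ ts) X =
    FR.trans (FR.+-cong (zᴹ-*ᴹ-constantTerm U (X j)) (combineₚ-constantTerm ts X)) (FR.+-identityˡ _)

  combineₚ-coefficient : ∀ ts X n →
                         coefficient (combineₚ ts X) (suc n) Fᴹ.≈ᴹ combine ts (λ j → coefficient (X j) n)
  combineₚ-coefficient []             X n = FR.refl
  combineₚ-coefficient ((U , j) ∷ ts) X n = FR.+-cong (zᴹ-*ᴹ-coefficient U (X j) n) (combineₚ-coefficient ts X n)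

  coefficientSolution-unique : ∀ {b X} → IsCoefficientSolution b → IsSeriesSolution X →
                               ∀ n i → b i n Fᴹ.≈ᴹ coefficient (X i) n
  coefficientSolution-unique {b} {X} (b₀ , b-suc) X-eq zero i = FR.sym (begin
    coefficient (X i) 0                                  ≈⟨ (λ p q → X-eq i p q 0) ⟩
    source i Fᴹ.+ᴹ coefficient (combineₚ (terms i) X) 0  ≈⟨ FR.+-congˡ (combineₚ-constantTerm (terms i) X) ⟩
    source i Fᴹ.+ᴹ Fᴹ.0ᴹ                                 ≈⟨ FR.+-identityʳ _ ⟩
    source i                                             ≈⟨ b₀ i ⟨
    b i 0                                                ∎)
    where open import Relation.Binary.Reasoning.Setoid FR.setoid
  coefficientSolution-unique {b} {X} (b₀ , b-suc) X-eq (suc n) i = begin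
    b i (suc n)
      ≈⟨ b-suc i n ⟩
    combine (terms i) (λ j → b j n)
      ≈⟨ combine-cong (terms i) (coefficientSolution-unique (b₀ , b-suc) X-eq n) ⟩
    combine (terms i) (λ j → coefficient (X j) n)
      ≈⟨ combineₚ-coefficient (terms i) X n ⟨
    coefficient (combineₚ (terms i) X) (suc n)
      ≈⟨ FR.+-identityˡ _ ⟨
    Fᴹ.0ᴹ Fᴹ.+ᴹ coefficient (combineₚ (terms i) X) (suc n)
      ≈⟨ (λ p q → sym (X-eq i p q (suc n))) ⟩
    coefficient (X i) (suc n) ∎
    where open import Relation.Binary.Reasoning.Setoid FR.setoid

module FieldMatrices {c ℓ} (F : Field c ℓ) where
  open Field F hiding (zero)
  open FieldDefs F
  module Fᴹ = Matrices commutativeRing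

  ΣF≡sum : ∀ n (f : Fin n → Carrier) → ΣF n f ≡ Fᴹ.sum f
  ΣF≡sum zero    f = ≡.refl
  ΣF≡sum (suc n) f = ≡.cong (λ x → f zero + x) (ΣF≡sum n (λ i → f (suc i)))

  ⊗≈*ᴹ : ∀ {s} (X Y : Mat s) → X ⊗ Y Fᴹ.≈ᴹ X Fᴹ.*ᴹ Y
  ⊗≈*ᴹ {s} X Y i j = reflexive (ΣF≡sum s _)

  1M≈1ᴹ : ∀ {s} → 1M {s} Fᴹ.≈ᴹ Fᴹ.1ᴹ
  1M≈1ᴹ i j with i ≟ j
  ... | yes _ = refl
  ... | no  _ = refl

module WalkSums {c ℓ} (F : Field c ℓ) {s : ℕ} (A B C : FieldDefs.Mat F s) where
  open Field F hiding (zero)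
  open FieldDefs F
  open Walks A B C
  open FieldMatrices F
  module FR = Ring (Fᴹ.matrixRing {s})
  open import Relation.Binary.Reasoning.Setoid FR.setoid

  move : Step → ℤ → ℤ
  move down = ℤ.pred
  move stay a = a
  move up   = ℤ.suc

  +diff≡move : ∀ a u → a +ℤ diff u ≡ move u a
  +diff≡move a down = ℤ.+-comm a -[1+ 0 ]
  +diff≡move a stay = ℤ.+-identityʳ a
  +diff≡move a up   = ℤ.+-comm a (+ 1)

  walkSource : ℤ → Mat s
  walkSource a with a ≟ℤ 0ℤ
  ... | yes _ = Fᴹ.1ᴹ
  ... | no  _ = Fᴹ.0ᴹ

  steps : ℤ → List Step → List (Mat s × ℤ)
  steps a = map (λ u → U u , move u a)

  walkTerms : ℤ → List (Mat s × ℤ)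
  walkTerms a = steps a (down ∷ stay ∷ up ∷ [])

  open LinearSystem F walkSource walkTerms
    using (IsCoefficientSolution; combine; combine-0ᴹ; combine-+ᴹ; combine-cong)

  walkSum : ℤ → List (List Step) → Mat s
  walkSum a L = sumM (map weight (filter (λ σ → endpoint a σ ≟ℤ 0ℤ) L))

  contribution : ℤ → List Step → Mat s
  contribution a σ with endpoint a σ ≟ℤ 0ℤ
  ... | yes _ = weight σ
  ... | no  _ = 0M

  walkSum-∷ : ∀ a σ L → walkSum a (σ ∷ L) Fᴹ.≈ᴹ contribution a σ Fᴹ.+ᴹ walkSum a L
  walkSum-∷ a σ L with endpoint a σ ≟ℤ 0ℤ
  ... | yes _ = FR.refl
  ... | no  _ = FR.sym (FR.+-identityˡ _)

  contribution-∷ : ∀ a u σ → contribution a (u ∷ σ) Fᴹ.≈ᴹ U u Fᴹ.*ᴹ contribution (move u a) σ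
  contribution-∷ a u σ =
    FR.trans first-step (FR.*-congˡ (FR.reflexive (≡.cong (λ b → contribution b σ) (+diff≡move a u))))
    where
    first-step : contribution a (u ∷ σ) Fᴹ.≈ᴹ U u Fᴹ.*ᴹ contribution (a +ℤ diff u) σ
    first-step with endpoint (a +ℤ diff u) σ ≟ℤ 0ℤ
    ... | yes _ = ⊗≈*ᴹ (U u) (weight σ)
    ... | no  _ = FR.sym (FR.zeroʳ (U u))

  walkSum-prepend : ∀ a σ us rest → walkSum a (map (_∷ σ) us ++ rest) Fᴹ.≈ᴹ
                    combine (steps a us) (λ b → contribution b σ) Fᴹ.+ᴹ walkSum a rest
  walkSum-prepend a σ []       rest = FR.sym (FR.+-identityˡ _)
  walkSum-prepend a σ (u ∷ us) rest = begin
    walkSum a ((u ∷ σ) ∷ (map (_∷ σ) us ++ rest))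
      ≈⟨ walkSum-∷ a (u ∷ σ) _ ⟩
    contribution a (u ∷ σ) Fᴹ.+ᴹ walkSum a (map (_∷ σ) us ++ rest)
      ≈⟨ FR.+-cong (contribution-∷ a u σ) (walkSum-prepend a σ us rest) ⟩
    U u Fᴹ.*ᴹ contribution (move u a) σ Fᴹ.+ᴹ
      (combine (steps a us) (λ b → contribution b σ) Fᴹ.+ᴹ walkSum a rest)
      ≈⟨ FR.+-assoc _ _ _ ⟨
    combine (steps a (u ∷ us)) (λ b → contribution b σ) Fᴹ.+ᴹ walkSum a rest ∎

  walkSum-extend : ∀ a us L → walkSum a (concatMap (λ σ → map (_∷ σ) us) L) Fᴹ.≈ᴹ
                   combine (steps a us) (λ b → walkSum b L)
  walkSum-extend a us []      = FR.sym (combine-0ᴹ (steps a us))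
  walkSum-extend a us (σ ∷ L) = begin
    walkSum a (map (_∷ σ) us ++ concatMap (λ σ → map (_∷ σ) us) L)
      ≈⟨ walkSum-prepend a σ us _ ⟩
    combine (steps a us) (λ b → contribution b σ) Fᴹ.+ᴹ walkSum a (concatMap (λ σ → map (_∷ σ) us) L)
      ≈⟨ FR.+-congˡ (walkSum-extend a us L) ⟩
    combine (steps a us) (λ b → contribution b σ) Fᴹ.+ᴹ combine (steps a us) (λ b → walkSum b L)
      ≈⟨ combine-+ᴹ (steps a us) _ _ ⟩
    combine (steps a us) (λ b → contribution b σ Fᴹ.+ᴹ walkSum b L)
      ≈⟨ combine-cong (steps a us) (λ b → FR.sym (walkSum-∷ b σ L)) ⟩
    combine (steps a us) (λ b → walkSum b (σ ∷ L)) ∎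

  -- Mcoef a l is definitionally walkSum a (allSteps l), and allSteps (suc l) the concatMap in walkSum-extend
  Mcoef-solution : IsCoefficientSolution Mcoef
  Mcoef-solution = initial , λ a l → walkSum-extend a (down ∷ stay ∷ up ∷ []) (allSteps l)
    where
    initial : ∀ a → Mcoef a 0 Fᴹ.≈ᴹ walkSource a
    initial a with a ≟ℤ 0ℤ
    ... | yes _ = FR.trans (FR.+-identityʳ _) 1M≈1ᴹ
    ... | no  _ = FR.refl

module JacobiRows {c ℓ} (F : Field c ℓ) {s : ℕ} (A B C D : FieldDefs.Mat F s) where
  open Field F hiding (zero)
  open FieldDefs F
  open Jacobi A B C D
  open FieldMatrices F
  module FR = Ring (Fᴹ.matrixRing {s})
  open import Relation.Binary.Reasoning.Setoid FR.setoid

  -- index j of the system stands for row j + 1 of W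
  jacobiSource : ℕ → Mat s
  jacobiSource zero    = Fᴹ.1ᴹ
  jacobiSource (suc _) = Fᴹ.0ᴹ

  jacobiTerms : ℕ → List (Mat s × ℕ)
  jacobiTerms zero    = (D , 0) ∷ (C , 1) ∷ []
  jacobiTerms (suc i) = (A , i) ∷ (B , suc i) ∷ (C , suc (suc i)) ∷ []

  open LinearSystem F jacobiSource jacobiTerms using (IsCoefficientSolution; combine)

  w-subdiagonal : ∀ j → w (suc j) j ≡ A
  w-subdiagonal j with suc j ≟ℕ suc j
  ... | yes _ = ≡.refl
  ... | no ne = ⊥-elim (ne ≡.refl)

  w-superdiagonal : ∀ j → w j (suc j) ≡ C
  w-superdiagonal j with j ≟ℕ suc (suc j) | suc j ≟ℕ suc j
  ... | yes j≡2+j | _     = ⊥-elim (<-irrefl j≡2+j (n≤1+n (suc j)))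
  ... | no _      | yes _ = ≡.refl
  ... | no _      | no ne = ⊥-elim (ne ≡.refl)

  w-diagonal : ∀ i → w (suc (suc i)) (suc (suc i)) ≡ B
  w-diagonal i with suc (suc i) ≟ℕ suc (suc (suc i)) | suc (suc (suc i)) ≟ℕ suc (suc i)
                  | suc (suc i) ≟ℕ suc (suc i) | suc (suc i) ≟ℕ 1
  ... | yes eq | _      | _     | _     = ⊥-elim (<-irrefl eq ≤-refl)
  ... | no _   | yes eq | _     | _     = ⊥-elim (<-irrefl (≡.sym eq) ≤-refl)
  ... | no _   | no _   | yes _ | no _  = ≡.refl
  ... | no _   | no _   | no ne | _     = ⊥-elim (ne ≡.refl)

  w-belowSubdiagonal : ∀ i m → suc m ≤ i → w (suc (suc i)) (suc m) ≡ 0M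
  w-belowSubdiagonal i m m<i with suc (suc i) ≟ℕ suc (suc m) | suc (suc (suc i)) ≟ℕ suc m | suc (suc i) ≟ℕ suc m
  ... | yes eq | _      | _      = ⊥-elim (<-irrefl (≡.sym eq) (s≤s (s≤s m<i)))
  ... | no _   | yes eq | _      =
    ⊥-elim (<-irrefl (≡.sym eq) (s≤s (≤-trans m<i (≤-trans (n≤1+n i) (n≤1+n (suc i))))))
  ... | no _   | no _   | yes eq = ⊥-elim (<-irrefl (≡.sym eq) (s≤s (≤-trans m<i (n≤1+n i))))
  ... | no _   | no _   | no _   = ≡.refl

  ΣM-zero : ∀ N f → (∀ m → suc m ≤ N → f (suc m) Fᴹ.≈ᴹ Fᴹ.0ᴹ) → ΣM N f Fᴹ.≈ᴹ Fᴹ.0ᴹ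
  ΣM-zero zero    f f≈0 = FR.refl
  ΣM-zero (suc N) f f≈0 =
    FR.trans (FR.+-cong (ΣM-zero N f (λ m m<N → f≈0 m (m≤n⇒m≤1+n m<N))) (f≈0 N ≤-refl)) (FR.+-identityˡ _)

  ⊗≈*ᴹ-≡ : ∀ {V U} X → V ≡ U → V ⊗ X Fᴹ.≈ᴹ U Fᴹ.*ᴹ X
  ⊗≈*ᴹ-≡ X V≡U = FR.trans (⊗≈*ᴹ _ X) (FR.*-congʳ (FR.reflexive V≡U))

  Wpow-solution : IsCoefficientSolution (λ j n → Wpow n (suc j) 1)
  Wpow-solution = initial , recursion
    where
    initial : ∀ j → Wpow 0 (suc j) 1 Fᴹ.≈ᴹ jacobiSource j
    initial zero    = 1M≈1ᴹ
    initial (suc j) = FR.refl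

    recursion : ∀ j n → Wpow (suc n) (suc j) 1 Fᴹ.≈ᴹ
                combine (jacobiTerms j) (λ i → Wpow n (suc i) 1)
    recursion zero n = begin
      Fᴹ.0ᴹ Fᴹ.+ᴹ D ⊗ Wpow n 1 1 Fᴹ.+ᴹ C ⊗ Wpow n 2 1
        ≈⟨ FR.+-cong (FR.trans (FR.+-identityˡ _) (⊗≈*ᴹ D _)) (⊗≈*ᴹ C _) ⟩
      D Fᴹ.*ᴹ Wpow n 1 1 Fᴹ.+ᴹ C Fᴹ.*ᴹ Wpow n 2 1
        ≈⟨ FR.+-congˡ (FR.+-identityʳ _) ⟨
      D Fᴹ.*ᴹ Wpow n 1 1 Fᴹ.+ᴹ (C Fᴹ.*ᴹ Wpow n 2 1 Fᴹ.+ᴹ Fᴹ.0ᴹ) ∎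
    recursion (suc i) n = begin
      ΣM i f Fᴹ.+ᴹ f (suc i) Fᴹ.+ᴹ f (suc (suc i)) Fᴹ.+ᴹ f (suc (suc (suc i)))
        ≈⟨ FR.+-cong (FR.+-cong (FR.+-cong (ΣM-zero i f far) (⊗≈*ᴹ-≡ x (w-subdiagonal (suc i))))
                                (⊗≈*ᴹ-≡ y (w-diagonal i)))
                     (⊗≈*ᴹ-≡ z (w-superdiagonal (suc (suc i)))) ⟩
      Fᴹ.0ᴹ Fᴹ.+ᴹ A Fᴹ.*ᴹ x Fᴹ.+ᴹ B Fᴹ.*ᴹ y Fᴹ.+ᴹ C Fᴹ.*ᴹ z
        ≈⟨ FR.trans (FR.+-congʳ (FR.+-congʳ (FR.+-identityˡ _))) (FR.+-assoc _ _ _) ⟩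
      A Fᴹ.*ᴹ x Fᴹ.+ᴹ (B Fᴹ.*ᴹ y Fᴹ.+ᴹ C Fᴹ.*ᴹ z)
        ≈⟨ FR.+-congˡ (FR.+-congˡ (FR.+-identityʳ _)) ⟨
      A Fᴹ.*ᴹ x Fᴹ.+ᴹ (B Fᴹ.*ᴹ y Fᴹ.+ᴹ (C Fᴹ.*ᴹ z Fᴹ.+ᴹ Fᴹ.0ᴹ)) ∎
      where
      x y z : Mat s
      x = Wpow n (suc i) 1
      y = Wpow n (suc (suc i)) 1
      z = Wpow n (suc (suc (suc i))) 1
      f : ℕ → Mat s
      f m = w (suc (suc i)) m ⊗ Wpow n m 1
      far : ∀ m → suc m ≤ i → f (suc m) Fᴹ.≈ᴹ Fᴹ.0ᴹ
      far m m<i = FR.trans (⊗≈*ᴹ-≡ _ (w-belowSubdiagonal i m m<i)) (FR.zeroˡ _)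

module SeriesEquations {c ℓ} (F : Field c ℓ) {s : ℕ} where
  open Field F hiding (zero)
  open FieldDefs F using (Mat)
  open SeriesMatrices F
  open SeriesInverse F
  module PR = Ring (matrixRing {s})
  open RingEquations (matrixRing {s}) public

  quadraticMap : (P Q S : Mat s) → Matrix s → Matrix s
  quadraticMap P Q S X = zᴹ P +ᴹ zᴹ Q *ᴹ X +ᴹ zᴹ S *ᴹ (X *ᴹ X)

  quadraticMap-contractive : ∀ P Q S {n X Y} →
                             X ≈ᴹ[< n ] Y → quadraticMap P Q S X ≈ᴹ[< suc n ] quadraticMap P Q S Y
  quadraticMap-contractive P Q S X≈Y =
    +ᴹ-agree (+ᴹ-agree (λ i j k _ → refl) (zᴹ-contract Q X≈Y)) (zᴹ-contract S (*ᴹ-agree X≈Y X≈Y))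

  quadraticFixpoint : (P Q S : Mat s) → Matrix s
  quadraticFixpoint P Q S = fixpointᴹ (quadraticMap P Q S) (quadraticMap-contractive P Q S)

  quadraticFixpoint-eq : ∀ P Q S → quadraticMap P Q S (quadraticFixpoint P Q S) ≈ᴹ quadraticFixpoint P Q S
  quadraticFixpoint-eq P Q S = fixpointᴹ-eq (quadraticMap P Q S) (quadraticMap-contractive P Q S)

  quadraticFixpoint-shift : ∀ P Q S Y → let X = quadraticFixpoint P Q S in
                            X *ᴹ Y ≈ᴹ zᴹ P *ᴹ Y +ᴹ zᴹ Q *ᴹ (X *ᴹ Y) +ᴹ zᴹ S *ᴹ (X *ᴹ (X *ᴹ Y))
  quadraticFixpoint-shift P Q S = quadratic-shift (zᴹ P) (zᴹ Q) (zᴹ S) _ (quadraticFixpoint-eq P Q S)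

  oneMinus-constantTerm : ∀ (Q : Matrix s) → coefficient Q 0 Fᴹ.≈ᴹ Fᴹ.0ᴹ → HasConstantTermOne (1ᴹ +ᴹ -ᴹ Q)
  oneMinus-constantTerm Q Q₀≈0 i j = trans (+-cong (sym (constᴹ-1ᴹ i j 0)) (-‿cong (Q₀≈0 i j)))
                                         (trans (+-congˡ ε⁻¹≈ε) (+-identityʳ _))
    where open import Algebra.Properties.Group +-group using (ε⁻¹≈ε)

  row : ∀ E {e} (x y z : Matrix s) → e ≈ᴹ constᴹ E →
        e +ᴹ (x +ᴹ y +ᴹ z) ≈ᴹ constᴹ E +ᴹ (x +ᴹ (y +ᴹ (z +ᴹ 0ᴹ)))
  row E x y z e≈E =
    PR.+-cong e≈E (PR.trans (PR.+-assoc x y z) (PR.+-congˡ (PR.+-congˡ (PR.sym (PR.+-identityʳ z)))))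

  trivialSubring : IsInverseClosedSubring {k = 0ℓ} (λ _ → ⊤)
  trivialSubring = record { ∈-resp = _ ; 0∈ = _ ; 1∈ = _ ; +∈ = _ ; -∈ = _ ; *∈ = _ ; inverse∈ = _ }

module WalkSeries {c ℓ} (F : Field c ℓ) {s : ℕ} (A B C : FieldDefs.Mat F s) where
  open Field F hiding (zero)
  open SeriesMatrices F
  open SeriesInverse F
  open SeriesEquations F {s}
  open WalkSums F A B C using (walkSource; walkTerms)
  open LinearSystem F walkSource walkTerms using (IsSeriesSolution)

  Fdown : Matrix s
  Fdown = quadraticFixpoint A B C

  Fup : Matrix s
  Fup = quadraticFixpoint C B A

  firstReturn : Matrix s
  firstReturn = zᴹ A *ᴹ Fup +ᴹ zᴹ B +ᴹ zᴹ C *ᴹ Fdown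

  firstReturn-constantTerm : coefficient firstReturn 0 Fᴹ.≈ᴹ Fᴹ.0ᴹ
  firstReturn-constantTerm i j =
    trans (+-cong (+-cong (zᴹ-*ᴹ-constantTerm A Fup i j) (zᴹ-constantTerm B i j)) (zᴹ-*ᴹ-constantTerm C Fdown i j))
          (trans (+-identityʳ _) (+-identityʳ _))

  private
    module OneMinusReturn⁻¹ = RightInverse (rightInverse trivialSubring (1ᴹ +ᴹ -ᴹ firstReturn)
                                (oneMinus-constantTerm firstReturn firstReturn-constantTerm) (λ _ _ → _))

  X₀ : Matrix s
  X₀ = OneMinusReturn⁻¹.inverse

  X₀-inverse : (1ᴹ +ᴹ -ᴹ firstReturn) *ᴹ X₀ ≈ᴹ 1ᴹ
  X₀-inverse = OneMinusReturn⁻¹.isRightInverse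

  walkSeries : ℤ → Matrix s
  walkSeries (+ n)    = fold X₀ (Fdown *ᴹ_) n
  walkSeries -[1+ n ] = fold X₀ (Fup *ᴹ_) (suc n)

  open import Relation.Binary.Reasoning.Setoid PR.setoid
  open import Algebra.Solver.CommutativeMonoid PR.+-commutativeMonoid using (solve; _⊕_; _⊜_; id)

  Fdown-row : ∀ W → Fdown *ᴹ W ≈ᴹ
              constᴹ Fᴹ.0ᴹ +ᴹ (zᴹ A *ᴹ W +ᴹ (zᴹ B *ᴹ (Fdown *ᴹ W) +ᴹ
                                             (zᴹ C *ᴹ (Fdown *ᴹ (Fdown *ᴹ W)) +ᴹ 0ᴹ)))
  Fdown-row W = begin
    Fdown *ᴹ W                 ≈⟨ quadraticFixpoint-shift A B C W ⟩
    x +ᴹ y +ᴹ z                ≈⟨ PR.+-identityˡ _ ⟨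
    0ᴹ +ᴹ (x +ᴹ y +ᴹ z)        ≈⟨ row Fᴹ.0ᴹ x y z (PR.sym constᴹ-0ᴹ) ⟩
    constᴹ Fᴹ.0ᴹ +ᴹ (x +ᴹ (y +ᴹ (z +ᴹ 0ᴹ))) ∎
    where
    x y z : Matrix s
    x = zᴹ A *ᴹ W
    y = zᴹ B *ᴹ (Fdown *ᴹ W)
    z = zᴹ C *ᴹ (Fdown *ᴹ (Fdown *ᴹ W))

  Fup-row : ∀ V → Fup *ᴹ V ≈ᴹ
            constᴹ Fᴹ.0ᴹ +ᴹ (zᴹ A *ᴹ (Fup *ᴹ (Fup *ᴹ V)) +ᴹ
                             (zᴹ B *ᴹ (Fup *ᴹ V) +ᴹ (zᴹ C *ᴹ V +ᴹ 0ᴹ)))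
  Fup-row V = begin
    Fup *ᴹ V                   ≈⟨ quadraticFixpoint-shift C B A V ⟩
    z +ᴹ y +ᴹ x                ≈⟨ solve 3 (λ a b c → (c ⊕ b) ⊕ a ⊜ id ⊕ ((a ⊕ b) ⊕ c)) PR.refl x y z ⟩
    0ᴹ +ᴹ (x +ᴹ y +ᴹ z)        ≈⟨ row Fᴹ.0ᴹ x y z (PR.sym constᴹ-0ᴹ) ⟩
    constᴹ Fᴹ.0ᴹ +ᴹ (x +ᴹ (y +ᴹ (z +ᴹ 0ᴹ))) ∎
    where
    x y z : Matrix s
    x = zᴹ A *ᴹ (Fup *ᴹ (Fup *ᴹ V))
    y = zᴹ B *ᴹ (Fup *ᴹ V)
    z = zᴹ C *ᴹ V

  walkSeries-solution : IsSeriesSolution walkSeries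
  walkSeries-solution (+ zero) = begin
    X₀                                       ≈⟨ rightInverse-expand firstReturn X₀ X₀-inverse ⟩
    1ᴹ +ᴹ firstReturn *ᴹ X₀                  ≈⟨ PR.+-congˡ distribute ⟩
    1ᴹ +ᴹ (x +ᴹ y +ᴹ z)                      ≈⟨ row Fᴹ.1ᴹ x y z (PR.sym constᴹ-1ᴹ) ⟩
    constᴹ Fᴹ.1ᴹ +ᴹ (x +ᴹ (y +ᴹ (z +ᴹ 0ᴹ))) ∎
    where
    x y z : Matrix s
    x = zᴹ A *ᴹ (Fup *ᴹ X₀)
    y = zᴹ B *ᴹ X₀
    z = zᴹ C *ᴹ (Fdown *ᴹ X₀)
    distribute : firstReturn *ᴹ X₀ ≈ᴹ x +ᴹ y +ᴹ z
    distribute = begin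
      (zᴹ A *ᴹ Fup +ᴹ zᴹ B +ᴹ zᴹ C *ᴹ Fdown) *ᴹ X₀
        ≈⟨ PR.distribʳ X₀ (zᴹ A *ᴹ Fup +ᴹ zᴹ B) (zᴹ C *ᴹ Fdown) ⟩
      (zᴹ A *ᴹ Fup +ᴹ zᴹ B) *ᴹ X₀ +ᴹ zᴹ C *ᴹ Fdown *ᴹ X₀
        ≈⟨ PR.+-congʳ (PR.distribʳ X₀ (zᴹ A *ᴹ Fup) (zᴹ B)) ⟩
      zᴹ A *ᴹ Fup *ᴹ X₀ +ᴹ y +ᴹ zᴹ C *ᴹ Fdown *ᴹ X₀
        ≈⟨ PR.+-cong (PR.+-congʳ (PR.*-assoc (zᴹ A) Fup X₀)) (PR.*-assoc (zᴹ C) Fdown X₀) ⟩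
      x +ᴹ y +ᴹ z ∎
  walkSeries-solution (+ suc n) = Fdown-row (walkSeries (+ n))
  -- walkSeries (ℤ.suc -[1+ n ]) reduces to fold X₀ (Fup *ᴹ_) n only once n is split
  walkSeries-solution -[1+ zero ]  = Fup-row X₀
  walkSeries-solution -[1+ suc n ] = Fup-row (fold X₀ (Fup *ᴹ_) (suc n))

module JacobiSeries {c ℓ} (F : Field c ℓ) {s : ℕ} (A B C D : FieldDefs.Mat F s) where
  open SeriesMatrices F
  open SeriesEquations F {s}
  open WalkSeries F A B C using (Fdown; Fdown-row)
  open JacobiRows F A B C D using (jacobiSource; jacobiTerms)
  open LinearSystem F jacobiSource jacobiTerms using (IsSeriesSolution)
  open import Relation.Binary.Reasoning.Setoid PR.setoid

  boundaryReturn : Matrix s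
  boundaryReturn = zᴹ D +ᴹ zᴹ C *ᴹ Fdown

  jacobiSeries : Matrix s → ℕ → Matrix s
  jacobiSeries H = fold H (Fdown *ᴹ_)

  jacobiSeries-solution : ∀ {H} → (1ᴹ +ᴹ -ᴹ boundaryReturn) *ᴹ H ≈ᴹ 1ᴹ → IsSeriesSolution (jacobiSeries H)
  jacobiSeries-solution {H} H-inverse zero = begin
    H                                                          ≈⟨ rightInverse-expand boundaryReturn H H-inverse ⟩
    1ᴹ +ᴹ boundaryReturn *ᴹ H                                  ≈⟨ PR.+-cong (PR.sym constᴹ-1ᴹ) distribute ⟩
    constᴹ Fᴹ.1ᴹ +ᴹ (zᴹ D *ᴹ H +ᴹ (zᴹ C *ᴹ (Fdown *ᴹ H) +ᴹ 0ᴹ)) ∎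
    where
    distribute : boundaryReturn *ᴹ H ≈ᴹ zᴹ D *ᴹ H +ᴹ (zᴹ C *ᴹ (Fdown *ᴹ H) +ᴹ 0ᴹ)
    distribute = PR.trans (PR.distribʳ H (zᴹ D) (zᴹ C *ᴹ Fdown))
                          (PR.+-congˡ (PR.trans (PR.*-assoc (zᴹ C) Fdown H) (PR.sym (PR.+-identityʳ _))))
  jacobiSeries-solution {H} H-inverse (suc i) = Fdown-row (jacobiSeries H i)

module 𝓛-Subring {c ℓ} (F : Field c ℓ) {s : ℕ} (A B C : FieldDefs.Mat F s) where
  open Field F hiding (zero)
  open FieldDefs F
  open PowerSeries F
  open SeriesMatrices F using (IsInverseClosedSubring; constP-0#)
  open Generated A B C
  open import Relation.Binary.Reasoning.Setoid P.setoid

  1ₚ-nonzero : NonzeroP 1ₚ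
  1ₚ-nonzero 1≈0 = 0≉1 (sym (1≈0 0))

  invertible⇒nonzero : ∀ f g → (f *ₚ g) ≈ₚ 1ₚ → NonzeroP f
  invertible⇒nonzero f g fg≈1 f≈0 =
    0≉1 (trans (sym (trans (constantTerm-*ₚ f g) (trans (*-congʳ (f≈0 0)) (zeroˡ _)))) (fg≈1 0))

  resp-over-1ₚ : ∀ {f g} → f ∈𝓛 → (f *ₚ 1ₚ) ≈ₚ (g *ₚ 1ₚ) → g ∈𝓛
  resp-over-1ₚ f∈ eq = resp f∈ eq 1ₚ-nonzero

  isInverseClosedSubring : IsInverseClosedSubring _∈𝓛
  isInverseClosedSubring = record
    { ∈-resp   = λ f≈g f∈ → resp-over-1ₚ f∈ (P.*-congʳ f≈g)
    ; 0∈       = resp-over-1ₚ (const 0#) (P.*-congʳ constP-0#)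
    ; 1∈       = const 1#
    ; +∈       = λ {f} {g} f∈ g∈ → resp (add f∈ g∈) (sum-over-1ₚ f g) 1ₚ-nonzero
    ; -∈       = neg
    ; *∈       = λ {f} {g} f∈ g∈ →
                   resp (mul f∈ g∈) (P.*-congˡ {f *ₚ g} (P.sym (P.*-identityʳ 1ₚ))) 1ₚ-nonzero
    ; inverse∈ = λ {f} {g} f∈ fg≈1 →
                   resp (inv f∈ (invertible⇒nonzero f g fg≈1))
                        (P.trans (P.*-identityʳ 1ₚ) (P.trans (P.sym fg≈1) (P.*-comm f g))) 1ₚ-nonzero
    }
    where
    sum-over-1ₚ : ∀ f g → (((f *ₚ 1ₚ) +ₚ (g *ₚ 1ₚ)) *ₚ 1ₚ) ≈ₚ ((f +ₚ g) *ₚ (1ₚ *ₚ 1ₚ))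
    sum-over-1ₚ f g = begin
      ((f *ₚ 1ₚ) +ₚ (g *ₚ 1ₚ)) *ₚ 1ₚ ≈⟨ P.*-identityʳ _ ⟩
      (f *ₚ 1ₚ) +ₚ (g *ₚ 1ₚ)         ≈⟨ P.+-cong (P.*-identityʳ f) (P.*-identityʳ g) ⟩
      f +ₚ g                         ≈⟨ P.*-identityʳ (f +ₚ g) ⟨
      (f +ₚ g) *ₚ 1ₚ                 ≈⟨ P.*-congˡ {f +ₚ g} (P.*-identityʳ 1ₚ) ⟨
      (f +ₚ g) *ₚ (1ₚ *ₚ 1ₚ)         ∎

module Corollary {c ℓ} (F : Field c ℓ) {s : ℕ} (A B C D : FieldDefs.Mat F s) where
  open Field F hiding (zero)
  open FieldDefs F using (_≈ₚ_)
  open FieldDefs.Jacobi F A B C D using (Wpow)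
  open FieldDefs.Generated F A B C using (_∈𝓛; entryP; var; const; gen₀; gen₁)
  open SeriesMatrices F
  open SeriesInverse F
  open SeriesEquations F {s}
  open WalkSums F A B C using (walkSource; walkTerms; Mcoef-solution)
  open WalkSeries F A B C using (Fdown; walkSeries; walkSeries-solution)
  open JacobiRows F A B C D using (jacobiSource; jacobiTerms; Wpow-solution)
  open JacobiSeries F A B C D
  open 𝓛-Subring F A B C using (isInverseClosedSubring)
  open IsInverseClosedSubring isInverseClosedSubring

  walkGF : ℤ → Matrix s
  walkGF a = entryP a

  walkGF≈walkSeries : ∀ a → walkGF a ≈ᴹ walkSeries a
  walkGF≈walkSeries a i j n =
    LinearSystem.coefficientSolution-unique F walkSource walkTerms Mcoef-solution walkSeries-solution n a i j

  Fdown-walkGF : Fdown *ᴹ walkGF 0ℤ ≈ᴹ walkGF (+ 1)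
  Fdown-walkGF = PR.trans (PR.*-congˡ {Fdown} (walkGF≈walkSeries 0ℤ)) (PR.sym (walkGF≈walkSeries (+ 1)))

  module M₀⁻¹ = RightInverse (rightInverse isInverseClosedSubring (walkGF 0ℤ) (proj₁ Mcoef-solution 0ℤ) gen₀)

  Fdown∈𝓛 : ∀ i j → Fdown i j ∈𝓛
  Fdown∈𝓛 i j =
    ∈-resp (PR.sym Fdown≈M₁M₀⁻¹ i j) (sum∈ (λ m → *∈ (gen₁ i m) (M₀⁻¹.entries∈ m j)))
    where
    Fdown≈M₁M₀⁻¹ : Fdown ≈ᴹ walkGF (+ 1) *ᴹ M₀⁻¹.inverse
    Fdown≈M₁M₀⁻¹ =
      rightInverse-solve Fdown (walkGF 0ℤ) (walkGF (+ 1)) M₀⁻¹.inverse Fdown-walkGF M₀⁻¹.isRightInverse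

  zᴹ∈𝓛 : ∀ (U : FieldDefs.Mat F s) i j → zᴹ U i j ∈𝓛
  zᴹ∈𝓛 U i j = *∈ var (const (U i j))

  boundaryReturn-constantTerm : coefficient boundaryReturn 0 Fᴹ.≈ᴹ Fᴹ.0ᴹ
  boundaryReturn-constantTerm i j =
    trans (+-cong (zᴹ-constantTerm D i j) (zᴹ-*ᴹ-constantTerm C Fdown i j)) (+-identityʳ _)

  module H = RightInverse (rightInverse isInverseClosedSubring (1ᴹ +ᴹ -ᴹ boundaryReturn)
               (oneMinus-constantTerm boundaryReturn boundaryReturn-constantTerm)
               (λ i j → +∈ (1ᴹ∈ i j)
                           (-∈ (+∈ (zᴹ∈𝓛 D i j) (sum∈ (λ m → *∈ (zᴹ∈𝓛 C i m) (Fdown∈𝓛 m j)))))))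

  jacobiSeries∈𝓛 : ∀ n i j → jacobiSeries H.inverse n i j ∈𝓛
  jacobiSeries∈𝓛 zero    i j = H.entries∈ i j
  jacobiSeries∈𝓛 (suc n) i j = sum∈ (λ m → *∈ (Fdown∈𝓛 i m) (jacobiSeries∈𝓛 n m j))

  Wpow≈jacobiSeries : ∀ j p q → (λ n → Wpow n (suc j) 1 p q) ≈ₚ jacobiSeries H.inverse j p q
  Wpow≈jacobiSeries j p q n = LinearSystem.coefficientSolution-unique F jacobiSource jacobiTerms
                                Wpow-solution (jacobiSeries-solution H.isRightInverse) n j p q

corollary5p4 : ∀ {c ℓ} (F : Field c ℓ) (s : ℕ) (A B C D : FieldDefs.Mat F s) (k : ℕ) → 1 ≤ k →
    ∀ (p q : Fin s) →
      FieldDefs.Generated._∈𝓛 F A B C (λ n → FieldDefs.Jacobi.Wpow F A B C D n k 1 p q)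
corollary5p4 F s A B C D (suc j) (s≤s z≤n) p q =
  ∈-resp (λ n → sym (Wpow≈jacobiSeries j p q n)) (jacobiSeries∈𝓛 j p q)
  where
  open Field F using (sym)
  open Corollary F A B C D
  open 𝓛-Subring F A B C using (isInverseClosedSubring)
  open SeriesMatrices F using (module IsInverseClosedSubring)
  open IsInverseClosedSubring isInverseClosedSubring using (∈-resp)
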